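{- Let $G$ be a finite group and $H$ a subgroup of $G$. Then $H$ is a perfect code of some Cayley sum graph of $G$ if and only if $G$ has a normal subset $X$ such that $X\cup\{1\}$ is a left transversal of $H$ in $G$.
   Context: A subset $X$ of $G$ is normal if $g^{ -1}Xg=X$ for all $g\in G$. For a normal subset $X$, the Cayley sum graph $\mathrm{CS}(G,X)$ has vertex set $G$, with distinct vertices $g,h$ adjacent iff $gh\in X$. A perfect code in a graph is an independent set $C$ of vertices such that every vertex outside $C$ has exactly one neighbour in $C$. -}

module Defs where

open import Data.Nat using (ℕ)
open import Data.Fin using (Fin)
open import Data.Fin.Subset using (Subset; _∈_; _∉_; _∪_; ⁅_⁆)
open import Data.Product using (Σ; _×_; _,_)
open import Relation.Binary.PropositionalEquality using (_≡_; _≢_)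
open import Relation.Nullary using (¬_)
open import Algebra.Structures using (IsGroup)

-- A finite group: a group structure on Fin n with propositional equality.
-- (Every finite group is isomorphic to one of this form.)
record FinGroup : Set where
  infixl 7 _∙_
  field
    n       : ℕ
    _∙_     : Fin n → Fin n → Fin n
    ε       : Fin n
    _⁻¹     : Fin n → Fin n
    isGroup : IsGroup _≡_ _∙_ ε _⁻¹

module _ (G : FinGroup) where
  open FinGroup G

  IsSubgroup : Subset n → Set
  IsSubgroup H = (ε ∈ H)
               × (∀ a b → a ∈ H → b ∈ H → (a ∙ b) ∈ H)
               × (∀ a → a ∈ H → (a ⁻¹) ∈ H)

  -- X is normal: g⁻¹ X g = X for all g, i.e.  y ∈ X ⇔ y ∈ g⁻¹ X g ⇔ g y g⁻¹ ∈ X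
  IsNormalSubset : Subset n → Set
  IsNormalSubset X = ∀ g y → (y ∈ X → (g ∙ y ∙ (g ⁻¹)) ∈ X)
                           × ((g ∙ y ∙ (g ⁻¹)) ∈ X → y ∈ X)

  CSAdj : Subset n → Fin n → Fin n → Set
  CSAdj X g h = (g ≢ h) × ((g ∙ h) ∈ X)

  IsPerfectCode : (Fin n → Fin n → Set) → Subset n → Set
  IsPerfectCode Adj C =
      (∀ c d → c ∈ C → d ∈ C → ¬ Adj c d)
    × (∀ g → g ∉ C →
         Σ (Fin n) λ c → (c ∈ C × Adj g c)
                         × (∀ c′ → c′ ∈ C → Adj g c′ → c′ ≡ c))

  -- T is a left transversal of H: every left coset gH meets T in exactly one element
  -- (t ∈ gH  ⇔  g⁻¹ t ∈ H)
  IsLeftTransversal : Subset n → Subset n → Set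
  IsLeftTransversal H T =
    ∀ g → Σ (Fin n) λ t → (t ∈ T × ((g ⁻¹) ∙ t) ∈ H)
                          × (∀ t′ → t′ ∈ T → ((g ⁻¹) ∙ t′) ∈ H → t′ ≡ t)

-- The coset gH contains exactly one element of X ∪ {1} precisely when the vertex g
-- has exactly one neighbour c ∈ H in CS(G, X ∖ {1}): for g ∉ H the neighbour c and
-- the representative t = g c determine each other, while for g ∈ H the representative
-- is 1 and independence of H says X ∖ {1} misses H. Removing 1 from X preserves normality,
-- and does not destroy a perfect code H, since g c = 1 with c ∈ H forces g ∈ H.
module Submission where

open import Defs
open import Data.Fin.Subset using (Subset; _∪_; ⁅_⁆)
open import Data.Product using (∃; _×_)
open import Function.Bundles using (_⇔_)

open import Algebra.Bundles using (Group)
import Algebra.Properties.Group as GroupProperties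
open import Algebra.Structures using (IsGroup)
open import Data.Fin using (Fin; _≟_)
open import Data.Fin.Subset using (_∈_; _∉_; _∩_; ∁)
open import Data.Fin.Subset.Properties
  using (_∈?_; x∈⁅x⁆; x∈⁅y⁆⇒x≡y; x≢y⇒x∉⁅y⁆; x∈∁p⇒x∉p; x∉p⇒x∈∁p; x∈p∩q⁺; x∈p∩q⁻; x∈p∪q⁺; x∈p∪q⁻)
open import Data.Nat using (ℕ)
open import Data.Product using (Σ; _,_; proj₁; proj₂)
open import Data.Sum using (_⊎_; inj₁; inj₂)
open import Function.Base using (_∘_)
open import Function.Bundles using (mk⇔)
open import Relation.Binary.PropositionalEquality
open import Relation.Nullary using (¬_; yes; no; contradiction)

infixl 6 _∖_

_∖_ : {m : ℕ} → Subset m → Fin m → Subset m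
p ∖ y = p ∩ ∁ ⁅ y ⁆

module _ {m : ℕ} {p : Subset m} {x y : Fin m} where

  x∈p∖y⁺ : x ∈ p → x ≢ y → x ∈ p ∖ y
  x∈p∖y⁺ x∈p x≢y = x∈p∩q⁺ (x∈p , x∉p⇒x∈∁p (x≢y⇒x∉⁅y⁆ x≢y))

  x∈p∖y⁻ : x ∈ p ∖ y → x ∈ p × x ≢ y
  x∈p∖y⁻ x∈p∖y with x∈p∩q⁻ p _ x∈p∖y
  ... | x∈p , x∈∁⁅y⁆ = x∈p , λ x≡y → x∈∁p⇒x∉p x∈∁⁅y⁆ (subst (_∈ ⁅ y ⁆) (sym x≡y) (x∈⁅x⁆ y))

  x∈p∖y⇒x∈p∪⁅y⁆ : x ∈ p ∖ y → x ∈ p ∪ ⁅ y ⁆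
  x∈p∖y⇒x∈p∪⁅y⁆ x∈p∖y = x∈p∪q⁺ (inj₁ (proj₁ (x∈p∖y⁻ x∈p∖y)))

  x∈p∪⁅y⁆⇒x≡y⊎x∈p∖y : x ∈ p ∪ ⁅ y ⁆ → x ≡ y ⊎ x ∈ p ∖ y
  x∈p∪⁅y⁆⇒x≡y⊎x∈p∖y x∈p∪⁅y⁆ with x ≟ y | x∈p∪q⁻ p _ x∈p∪⁅y⁆
  ... | yes x≡y | _            = inj₁ x≡y
  ... | no  x≢y | inj₁ x∈p     = inj₂ (x∈p∖y⁺ x∈p x≢y)
  ... | no  x≢y | inj₂ x∈⁅y⁆   = contradiction (x∈⁅y⁆⇒x≡y y x∈⁅y⁆) x≢y

y∈p∪⁅y⁆ : {m : ℕ} {p : Subset m} (y : Fin m) → y ∈ p ∪ ⁅ y ⁆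
y∈p∪⁅y⁆ y = x∈p∪q⁺ (inj₂ (x∈⁅x⁆ y))

module _ (G : FinGroup) where
  open FinGroup G
  open IsGroup isGroup using (identityˡ; identityʳ; inverseˡ; inverseʳ)

  group : Group _ _
  group = record { isGroup = isGroup }

  open GroupProperties group
    using (\\-leftDividesˡ; \\-leftDividesʳ; ⁻¹-involutive; x∙y⁻¹≈ε⇒x≈y)

  conj-ε : ∀ g → g ∙ ε ∙ g ⁻¹ ≡ ε
  conj-ε g = trans (cong (_∙ g ⁻¹) (identityʳ g)) (inverseʳ g)

  conj≡ε⇒≡ε : ∀ g y → g ∙ y ∙ g ⁻¹ ≡ ε → y ≡ ε
  conj≡ε⇒≡ε g y gyg⁻¹≡ε = begin
    y              ≡⟨ \\-leftDividesʳ g y ⟨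
    g ⁻¹ ∙ (g ∙ y) ≡⟨ cong (g ⁻¹ ∙_) (x∙y⁻¹≈ε⇒x≈y (g ∙ y) g gyg⁻¹≡ε) ⟩
    g ⁻¹ ∙ g       ≡⟨ inverseˡ g ⟩
    ε              ∎
    where open ≡-Reasoning

  ⁅ε⁆-normal : IsNormalSubset G ⁅ ε ⁆
  ⁅ε⁆-normal g y =
      (λ y∈⁅ε⁆ → subst (λ z → g ∙ z ∙ g ⁻¹ ∈ ⁅ ε ⁆) (sym (x∈⁅y⁆⇒x≡y ε y∈⁅ε⁆))
                       (subst (_∈ ⁅ ε ⁆) (sym (conj-ε g)) (x∈⁅x⁆ ε)))
    , (λ conj∈⁅ε⁆ → subst (_∈ ⁅ ε ⁆) (sym (conj≡ε⇒≡ε g y (x∈⁅y⁆⇒x≡y ε conj∈⁅ε⁆))) (x∈⁅x⁆ ε))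

  ∁-normal : ∀ {X} → IsNormalSubset G X → IsNormalSubset G (∁ X)
  ∁-normal X-normal g y =
      (λ y∈∁X → x∉p⇒x∈∁p (x∈∁p⇒x∉p y∈∁X ∘ proj₂ (X-normal g y)))
    , (λ conj∈∁X → x∉p⇒x∈∁p (x∈∁p⇒x∉p conj∈∁X ∘ proj₁ (X-normal g y)))

  ∩-normal : ∀ {X Y} → IsNormalSubset G X → IsNormalSubset G Y → IsNormalSubset G (X ∩ Y)
  ∩-normal {X} {Y} X-normal Y-normal g y =
      (λ y∈X∩Y → let y∈X , y∈Y = x∈p∩q⁻ X Y y∈X∩Y in
                 x∈p∩q⁺ (proj₁ (X-normal g y) y∈X , proj₁ (Y-normal g y) y∈Y))
    , (λ conj∈X∩Y → let conj∈X , conj∈Y = x∈p∩q⁻ X Y conj∈X∩Y in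
                    x∈p∩q⁺ (proj₂ (X-normal g y) conj∈X , proj₂ (Y-normal g y) conj∈Y))

  ∖ε-normal : ∀ {X} → IsNormalSubset G X → IsNormalSubset G (X ∖ ε)
  ∖ε-normal X-normal = ∩-normal X-normal (∁-normal ⁅ε⁆-normal)

  module _ {H : Subset n} (H-subgroup : IsSubgroup G H) where

    private
      ε∈H : ε ∈ H
      ε∈H = proj₁ H-subgroup

      ∙-closed : ∀ {a b} → a ∈ H → b ∈ H → a ∙ b ∈ H
      ∙-closed = proj₁ (proj₂ H-subgroup) _ _

      ⁻¹-closed : ∀ {a} → a ∈ H → a ⁻¹ ∈ H
      ⁻¹-closed = proj₂ (proj₂ H-subgroup) _

    infix 4 _∈_·H

    _∈_·H : Fin n → Fin n → Set
    t ∈ g ·H = g ⁻¹ ∙ t ∈ H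

    ∈H⇒∈·H : ∀ {g t} → g ∈ H → t ∈ H → t ∈ g ·H
    ∈H⇒∈·H g∈H t∈H = ∙-closed (⁻¹-closed g∈H) t∈H

    ∈·H⇒∈H : ∀ {g t} → g ∈ H → t ∈ g ·H → t ∈ H
    ∈·H⇒∈H {g} {t} g∈H t∈gH = subst (_∈ H) (\\-leftDividesˡ g t) (∙-closed g∈H t∈gH)

    ∙∈·H : ∀ {g c} → c ∈ H → g ∙ c ∈ g ·H
    ∙∈·H {g} {c} c∈H = subst (_∈ H) (sym (\\-leftDividesʳ g c)) c∈H

    ε∈·H⇒∈H : ∀ {g} → ε ∈ g ·H → g ∈ H
    ε∈·H⇒∈H {g} ε∈gH =
      subst (_∈ H) (⁻¹-involutive g) (⁻¹-closed (subst (_∈ H) (identityʳ (g ⁻¹)) ε∈gH))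

    ∉H⇒∙≢ε : ∀ {g c} → g ∉ H → c ∈ H → g ∙ c ≢ ε
    ∉H⇒∙≢ε g∉H c∈H gc≡ε = g∉H (ε∈·H⇒∈H (subst (_∈ _ ·H) gc≡ε (∙∈·H c∈H)))

    ∉H⇒≢∈H : ∀ {g c} → g ∉ H → c ∈ H → g ≢ c
    ∉H⇒≢∈H g∉H c∈H g≡c = g∉H (subst (_∈ H) (sym g≡c) c∈H)

    ∈·H⇒adjacent : ∀ {Y g t} → g ∉ H → t ∈ Y → t ∈ g ·H → CSAdj G Y g (g ⁻¹ ∙ t)
    ∈·H⇒adjacent {Y} {g} {t} g∉H t∈Y t∈gH =
      ∉H⇒≢∈H g∉H t∈gH , subst (_∈ Y) (sym (\\-leftDividesˡ g t)) t∈Y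

    ∈∪⁅ε⁆∩·H⇒∈∖ε : ∀ {X g t} → g ∉ H → t ∈ X ∪ ⁅ ε ⁆ → t ∈ g ·H → t ∈ X ∖ ε
    ∈∪⁅ε⁆∩·H⇒∈∖ε g∉H t∈X∪⁅ε⁆ t∈gH with x∈p∪⁅y⁆⇒x≡y⊎x∈p∖y t∈X∪⁅ε⁆
    ... | inj₁ refl  = contradiction (ε∈·H⇒∈H t∈gH) g∉H
    ... | inj₂ t∈X∖ε = t∈X∖ε

    perfectCode-∖ε : ∀ {X} → IsPerfectCode G (CSAdj G X) H → IsPerfectCode G (CSAdj G (X ∖ ε)) H
    perfectCode-∖ε {X} (independent , dominating) = independent′ , dominating′
      where
      weaken : ∀ {g c} → CSAdj G (X ∖ ε) g c → CSAdj G X g c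
      weaken (g≢c , gc∈X∖ε) = g≢c , proj₁ (x∈p∖y⁻ gc∈X∖ε)

      independent′ : ∀ c d → c ∈ H → d ∈ H → ¬ CSAdj G (X ∖ ε) c d
      independent′ c d c∈H d∈H = independent c d c∈H d∈H ∘ weaken

      dominating′ : ∀ g → g ∉ H → Σ (Fin n) λ c → (c ∈ H × CSAdj G (X ∖ ε) g c)
                                  × (∀ c′ → c′ ∈ H → CSAdj G (X ∖ ε) g c′ → c′ ≡ c)
      dominating′ g g∉H with dominating g g∉H
      ... | c , (c∈H , g≢c , gc∈X) , unique =
        c , (c∈H , g≢c , x∈p∖y⁺ gc∈X (∉H⇒∙≢ε g∉H c∈H)) , λ c′ c′∈H → unique c′ c′∈H ∘ weaken

    perfectCode⇒transversal : ∀ {X} → IsPerfectCode G (CSAdj G (X ∖ ε)) H →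
                              IsLeftTransversal G H (X ∪ ⁅ ε ⁆)
    perfectCode⇒transversal {X} (independent , dominating) g with g ∈? H
    ... | yes g∈H = ε , (y∈p∪⁅y⁆ ε , ∈H⇒∈·H g∈H ε∈H) , unique
      where
      unique : ∀ t → t ∈ X ∪ ⁅ ε ⁆ → t ∈ g ·H → t ≡ ε
      unique t t∈X∪⁅ε⁆ t∈gH with x∈p∪⁅y⁆⇒x≡y⊎x∈p∖y t∈X∪⁅ε⁆
      ... | inj₁ t≡ε   = t≡ε
      ... | inj₂ t∈X∖ε =
        contradiction (proj₂ (x∈p∖y⁻ t∈X∖ε) ∘ sym , subst (_∈ X ∖ ε) (sym (identityˡ t)) t∈X∖ε)
                      (independent ε t ε∈H (∈·H⇒∈H g∈H t∈gH))
    ... | no g∉H with dominating g g∉H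
    ... | c , (c∈H , _ , gc∈X∖ε) , unique-c =
      g ∙ c , (x∈p∖y⇒x∈p∪⁅y⁆ gc∈X∖ε , ∙∈·H c∈H) , unique
      where
      unique : ∀ t → t ∈ X ∪ ⁅ ε ⁆ → t ∈ g ·H → t ≡ g ∙ c
      unique t t∈X∪⁅ε⁆ t∈gH = begin
        t              ≡⟨ \\-leftDividesˡ g t ⟨
        g ∙ (g ⁻¹ ∙ t) ≡⟨ cong (g ∙_) (unique-c _ t∈gH (∈·H⇒adjacent g∉H t∈X∖ε t∈gH)) ⟩
        g ∙ c          ∎
        where
        open ≡-Reasoning
        t∈X∖ε = ∈∪⁅ε⁆∩·H⇒∈∖ε g∉H t∈X∪⁅ε⁆ t∈gH

    transversal⇒perfectCode : ∀ {X} → IsLeftTransversal G H (X ∪ ⁅ ε ⁆) →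
                              IsPerfectCode G (CSAdj G (X ∖ ε)) H
    transversal⇒perfectCode {X} transversal = independent , dominating
      where
      independent : ∀ c d → c ∈ H → d ∈ H → ¬ CSAdj G (X ∖ ε) c d
      independent c d c∈H d∈H (_ , cd∈X∖ε) with transversal ε
      ... | _ , _ , unique = proj₂ (x∈p∖y⁻ cd∈X∖ε) (begin
        c ∙ d ≡⟨ unique (c ∙ d) (x∈p∖y⇒x∈p∪⁅y⁆ cd∈X∖ε) (∈H⇒∈·H ε∈H (∙-closed c∈H d∈H)) ⟩
        _     ≡⟨ unique ε (y∈p∪⁅y⁆ ε) (∈H⇒∈·H ε∈H ε∈H) ⟨
        ε     ∎)
        where open ≡-Reasoning

      dominating : ∀ g → g ∉ H → Σ (Fin n) λ c → (c ∈ H × CSAdj G (X ∖ ε) g c)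
                                 × (∀ c′ → c′ ∈ H → CSAdj G (X ∖ ε) g c′ → c′ ≡ c)
      dominating g g∉H with transversal g
      ... | t , (t∈X∪⁅ε⁆ , t∈gH) , unique-t =
        g ⁻¹ ∙ t , (t∈gH , ∈·H⇒adjacent g∉H (∈∪⁅ε⁆∩·H⇒∈∖ε g∉H t∈X∪⁅ε⁆ t∈gH) t∈gH) , unique
        where
        unique : ∀ c → c ∈ H → CSAdj G (X ∖ ε) g c → c ≡ g ⁻¹ ∙ t
        unique c c∈H (_ , gc∈X∖ε) = begin
          c              ≡⟨ \\-leftDividesʳ g c ⟨
          g ⁻¹ ∙ (g ∙ c) ≡⟨ cong (g ⁻¹ ∙_) (unique-t (g ∙ c) (x∈p∖y⇒x∈p∪⁅y⁆ gc∈X∖ε) (∙∈·H c∈H)) ⟩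
          g ⁻¹ ∙ t       ∎
          where open ≡-Reasoning

lemma3p1 : (G : FinGroup) (H : Subset (FinGroup.n G)) → IsSubgroup G H →
    (∃ λ X → IsNormalSubset G X × IsPerfectCode G (CSAdj G X) H)
      ⇔ (∃ λ X → IsNormalSubset G X × IsLeftTransversal G H (X ∪ ⁅ FinGroup.ε G ⁆))
lemma3p1 G H H-subgroup = mk⇔
  (λ (X , X-normal , perfect) →
     X , X-normal , perfectCode⇒transversal G H-subgroup (perfectCode-∖ε G H-subgroup perfect))
  (λ (X , X-normal , transversal) →
     X ∖ FinGroup.ε G , ∖ε-normal G X-normal , transversal⇒perfectCode G H-subgroup transversal)
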